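{- Let $G$ be a directed graph on vertex set $[n]$ consisting of a collection of vertex-disjoint 2-cycles together with self loops, where every edge is labeled by a distinct variable or by a constant from $R$. Then there is an algebraic branching program of size $2^{O({\sf cut}(G))}n^2$ computing the Cayley permanent of $G$.
   Context: $R$ is an associative algebra with identity over a field $\mathbb{K}$; variables are non-commuting. An algebraic branching program (ABP) is a directed acyclic graph with two distinguished nodes $s,t$ whose edges are labeled by variables or constants of $R$; the weight of a path is the product of its edge labels in path order and the ABP computes the sum of weights of all $s\leadsto t$ paths; its size is the number of nodes. The Cayley permanent of $G$ is ${\sf C}\mbox{ - }{\sf perm}(G)=\sum_{\sigma\in S_n}w(1,\sigma(1))\cdots w(n,\sigma(n))$ (product in this order), where $w(i,j)$ is the label of edge $(i,j)$ and $0$ if there is no such edge. The 2-cycles $(a_1,b_1),\ldots$ of $G$ determine the involution $\pi=(a_1\,b_1)(a_2\,b_2)\cdots$. For $1\le i\le n$, $C_i(\pi)$ is the set of transpositions $\{j,\pi(j)\}$ of $\pi$ (with $j\ne\pi(j)$) satisfying $\min(j,\pi(j))\le i\le\max(j,\pi(j))$, and ${\sf cut}(G)={\sf cut}(\pi)=\max_{1\le k\le n}|C_k(\pi)|$. -}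

module Defs where

open import Level using (Level; _⊔_) renaming (suc to lsuc)
open import Algebra.Bundles using (CommutativeRing; Ring)
open import Data.Nat as ℕ using (ℕ; zero; suc; _<_; _≤ᵇ_; _<ᵇ_)
open import Data.Fin using (Fin; toℕ; _≟_)
open import Data.Bool using (Bool; true; false; _∧_; _∨_; not; if_then_else_)
open import Data.List using (List; []; _∷_; [_]; map; concatMap; foldr; filterᵇ; length; upTo; allFin)
open import Data.List.Relation.Unary.All using (All)
open import Data.Bool.ListAction using (all)
open import Data.Maybe using (Maybe; just; nothing; maybe)
open import Data.Product using (_×_; _,_; proj₁; proj₂; ∃)
open import Data.Sum using (_⊎_)
open import Relation.Nullary using (¬_)
open import Relation.Nullary.Decidable using (⌊_⌋)
open import Relation.Binary.PropositionalEquality using (_≡_)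

record Field (c ℓ : Level) : Set (lsuc (c ⊔ ℓ)) where
  field
    commutativeRing : CommutativeRing c ℓ
  open CommutativeRing commutativeRing public
  field
    0≉1     : ¬ (0# ≈ 1#)
    inverse : ∀ x → ¬ (x ≈ 0#) → ∃ λ y → (x * y) ≈ 1#

record Algebra {a ℓa} (K : Field a ℓa) (r ℓr : Level) : Set (a ⊔ ℓa ⊔ lsuc (r ⊔ ℓr)) where
  module K = Field K
  field
    ring : Ring r ℓr
  open Ring ring public
  field
    ι       : K.Carrier → Carrier
    ι-cong  : ∀ {x y} → x K.≈ y → ι x ≈ ι y
    ι-+     : ∀ x y → ι (x K.+ y) ≈ (ι x + ι y)
    ι-*     : ∀ x y → ι (x K.* y) ≈ (ι x * ι y)
    ι-1     : ι K.1# ≈ 1#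
    central : ∀ k x → (ι k * x) ≈ (x * ι k)

module Over {a ℓa r ℓr} (K : Field a ℓa) (𝓡 : Algebra K r ℓr) where
  open Algebra 𝓡 using (Carrier; _≈_; _+_; _*_; 0#; 1#; -_; ι)

  data Label : Set r where
    var   : ℕ → Label
    const : Carrier → Label

  -- Non-commutative polynomials: the K-algebra freely generated by R and
  -- non-commuting variables x₀, x₁, …  (terms modulo the congruence _≃_).
  data Poly : Set r where
    X    : ℕ → Poly
    C    : Carrier → Poly
    _⊕_  : Poly → Poly → Poly
    _⊗_  : Poly → Poly → Poly

  infixl 6 _⊕_
  infixl 7 _⊗_
  infix 4 _≃_

  data _≃_ : Poly → Poly → Set (a ⊔ r ⊔ ℓr) where
    ≃-refl   : ∀ {p} → p ≃ p
    ≃-sym    : ∀ {p q} → p ≃ q → q ≃ p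
    ≃-trans  : ∀ {p q s} → p ≃ q → q ≃ s → p ≃ s
    ⊕-cong   : ∀ {p p′ q q′} → p ≃ p′ → q ≃ q′ → p ⊕ q ≃ p′ ⊕ q′
    ⊗-cong   : ∀ {p p′ q q′} → p ≃ p′ → q ≃ q′ → p ⊗ q ≃ p′ ⊗ q′
    ⊕-assoc  : ∀ p q s → (p ⊕ q) ⊕ s ≃ p ⊕ (q ⊕ s)
    ⊕-comm   : ∀ p q → p ⊕ q ≃ q ⊕ p
    ⊕-idˡ    : ∀ p → C 0# ⊕ p ≃ p
    ⊕-invʳ   : ∀ p → p ⊕ C (- 1#) ⊗ p ≃ C 0#
    ⊗-assoc  : ∀ p q s → (p ⊗ q) ⊗ s ≃ p ⊗ (q ⊗ s)
    ⊗-idˡ    : ∀ p → C 1# ⊗ p ≃ p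
    ⊗-idʳ    : ∀ p → p ⊗ C 1# ≃ p
    distribˡ : ∀ p q s → p ⊗ (q ⊕ s) ≃ p ⊗ q ⊕ p ⊗ s
    distribʳ : ∀ p q s → (q ⊕ s) ⊗ p ≃ q ⊗ p ⊕ s ⊗ p
    C-cong   : ∀ {x y} → x ≈ y → C x ≃ C y
    C-+      : ∀ x y → C (x + y) ≃ C x ⊕ C y
    C-*      : ∀ x y → C (x * y) ≃ C x ⊗ C y
    K-central : ∀ k p → C (ι k) ⊗ p ≃ p ⊗ C (ι k)

  ⟦_⟧ : Label → Poly
  ⟦ var x ⟧   = X x
  ⟦ const c ⟧ = C c

  ΣP : List Poly → Poly
  ΣP = foldr _⊕_ (C 0#)

  ΠP : List Poly → Poly
  ΠP = foldr _⊗_ (C 1#)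

  -- Acyclicity is expressed by requiring the
  -- node numbering to be a topological order (every DAG admits one).

  record ABP : Set r where
    field
      size    : ℕ
      s t     : Fin size
      edges   : List (Fin size × Fin size × Label)
      acyclic : All (λ e → toℕ (proj₁ e) < toℕ (proj₁ (proj₂ e))) edges

    pathsFrom : ℕ → Fin size → List (List Label)
    pathsFrom zero    u = if ⌊ u ≟ t ⌋ then [ [] ] else []
    pathsFrom (suc k) u =
      concatMap (λ e → if ⌊ proj₁ e ≟ u ⌋
                         then map (proj₂ (proj₂ e) ∷_) (pathsFrom k (proj₁ (proj₂ e)))
                         else [])
                edges

    -- all s ⇝ t paths (in a topologically ordered DAG every path has < size edges)
    stPaths : List (List Label)
    stPaths = concatMap (λ k → pathsFrom k s) (upTo (suc size))

    output : Poly
    output = ΣP (map (λ w → ΠP (map ⟦_⟧ w)) stPaths)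

  open ABP public using (size; output)

  -- Graphs on [n] that are vertex-disjoint 2-cycles plus self loops.
  -- w i j = just ℓ : edge (i , j) with label ℓ;  nothing : no edge.
  -- π is the involution given by the 2-cycles (fixed points elsewhere).

  record TwoCycleGraph (n : ℕ) : Set r where
    field
      π         : Fin n → Fin n
      π-invol   : ∀ i → π (π i) ≡ i
      w         : Fin n → Fin n → Maybe Label
      support   : ∀ i j ℓ → w i j ≡ just ℓ → (j ≡ i ⊎ j ≡ π i)
      twoCycles : ∀ i → ¬ (π i ≡ i) → ∃ λ ℓ → w i (π i) ≡ just ℓ
      distinctVars : ∀ i j i′ j′ x → w i j ≡ just (var x) → w i′ j′ ≡ just (var x)
                     → (i ≡ i′ × j ≡ j′)

  -- Symmetric group S_n: all injective (hence bijective) maps Fin n → Fin n.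

  allFuns : ∀ n m → List (Fin n → Fin m)
  allFuns zero    m = [ (λ ()) ]
  allFuns (suc n) m = concatMap (λ f → map (λ j → cons j f) (allFin m)) (allFuns n m)
    where
      cons : Fin m → (Fin n → Fin m) → Fin (suc n) → Fin m
      cons j f Fin.zero    = j
      cons j f (Fin.suc i) = f i

  isInjectiveᵇ : ∀ {n} → (Fin n → Fin n) → Bool
  isInjectiveᵇ {n} f =
    all (λ i → all (λ j → ⌊ i ≟ j ⌋ ∨ not ⌊ f i ≟ f j ⌋) (allFin n)) (allFin n)

  permutations : ∀ n → List (Fin n → Fin n)
  permutations n = filterᵇ isInjectiveᵇ (allFuns n n)

  C-perm : ∀ {n} → TwoCycleGraph n → Poly
  C-perm {n} G = ΣP (map (λ σ → ΠP (map (λ i → wt i (σ i)) (allFin n))) (permutations n))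
    where
      wt : Fin n → Fin n → Poly
      wt i j = maybe ⟦_⟧ (C 0#) (TwoCycleGraph.w G i j)

  -- |C_k(π)|: number of transpositions {j , π j} (counted via j < π j)
  -- with j ≤ k ≤ π j.
  crossing : ∀ {n} → (Fin n → Fin n) → Fin n → ℕ
  crossing {n} π k =
    length (filterᵇ (λ j → (toℕ j <ᵇ toℕ (π j)) ∧ (toℕ j ≤ᵇ toℕ k) ∧ (toℕ k ≤ᵇ toℕ (π j)))
                    (allFin n))

  cutπ : ∀ {n} → (Fin n → Fin n) → ℕ
  cutπ {n} π = foldr ℕ._⊔_ 0 (map (crossing π) (allFin n))

  cut : ∀ {n} → TwoCycleGraph n → ℕ
  cut G = cutπ (TwoCycleGraph.π G)

module Submission where

open import Defs
open import Level using (Level)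
open import Data.Nat as ℕ using (ℕ; zero; suc; _≤_; _<_; _+_; _*_; _^_; _⊔_; _≡ᵇ_; _<ᵇ_; _≤ᵇ_; z≤n; s≤s; _<?_)
import Data.Nat.Properties as ℕP
open import Data.Fin as Fin using (Fin; zero; suc; toℕ; _≟_; fromℕ<; combine; remQuot)
import Data.Fin.Properties as FinP
open import Data.Fin.Properties using (0≢1+n)
open import Data.Bool using (Bool; true; false; _∧_; _∨_; not; if_then_else_; T)
open import Data.Bool.Properties using (T-≡; T-∧; ∨-zeroʳ; ∨-identityʳ)
import Data.Bool.Properties as BoolP
open import Data.Bool.ListAction using (all; and)
open import Data.List as List using (List; []; _∷_; [_]; map; concatMap; filterᵇ; length; tabulate; allFin; _++_; upTo; foldr)
import Data.List.Properties as LP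
open import Data.List.Relation.Unary.All as All using (All; []; _∷_)
import Data.List.Relation.Unary.All.Properties as AllP
open import Data.List.Relation.Unary.Any as Any using (here; there)
open import Data.List.Relation.Unary.Any.Properties using (lookup-index)
open import Data.List.Membership.Propositional using (_∈_)
open import Data.List.Membership.Propositional.Properties using (∈-map⁺; ∈-++⁺ˡ; ∈-++⁺ʳ; ∈-filter⁺; ∈-filter⁻; ∈-allFin)
open import Data.Vec using (Vec; []; _∷_; lookup; _[_]≔_; replicate)
import Data.Vec.Properties as VecP
open import Data.Maybe using (Maybe; just; nothing; maybe)
open import Data.Product using (∃; ∃₂; _×_; _,_; proj₁; proj₂)
open import Data.Sum using (_⊎_; inj₁; inj₂)
open import Data.Unit using (tt)
open import Data.Empty using (⊥-elim)
open import Relation.Nullary using (¬_; Dec; yes; no; does; _×-dec_)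
open import Relation.Nullary.Decidable using (⌊_⌋; dec-true; dec-false; does-⇔; isYes≗does; T?)
open import Relation.Binary using (Setoid)
open import Relation.Binary.Definitions using (DecidableEquality)
open import Relation.Binary.PropositionalEquality using (_≡_; _≢_; refl; sym; trans; cong; cong₂; subst)
open import Function using (_∘_; id; _⇔_; mk⇔; Equivalence)

-- Every edge of G joins i to i or to its partner π i, so a permutation contributes to
-- C-perm(G) only if each row i takes column i or column π i.  Reading the rows in order,
-- all that must be remembered about the rows already read is, for every 2-cycle
-- {x < π x} cut by the current row (row x read, row π x not yet), which of the two
-- columns row x took: at most cut(G) bits.  This is a layered state machine with at most
-- 2^cut(G) states per layer, and such a machine is an ABP.

countIn : ∀ {a} {A : Set a} → (A → Bool) → List A → ℕ
countIn p xs = length (filterᵇ p xs)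

countIn-++ : ∀ {a} {A : Set a} (p : A → Bool) xs ys →
             countIn p (xs ++ ys) ≡ countIn p xs + countIn p ys
countIn-++ p []       ys = refl
countIn-++ p (x ∷ xs) ys with p x
... | true  = cong suc (countIn-++ p xs ys)
... | false = countIn-++ p xs ys

countIn-map : ∀ {a b} {A : Set a} {B : Set b} (p : B → Bool) (f : A → B) xs →
              countIn p (map f xs) ≡ countIn (p ∘ f) xs
countIn-map p f []       = refl
countIn-map p f (x ∷ xs) with p (f x)
... | true  = cong suc (countIn-map p f xs)
... | false = countIn-map p f xs

countIn-none : ∀ {a} {A : Set a} (xs : List A) → countIn (λ _ → false) xs ≡ 0
countIn-none []       = refl
countIn-none (x ∷ xs) = countIn-none xs

countIn-mono : ∀ {a} {A : Set a} (p q : A → Bool) → (∀ x → p x ≡ true → q x ≡ true) →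
               ∀ xs → countIn p xs ≤ countIn q xs
countIn-mono p q p⇒q []       = z≤n
countIn-mono p q p⇒q (x ∷ xs) with p x in px | q x in qx
... | true  | true  = s≤s (countIn-mono p q p⇒q xs)
... | false | true  = ℕP.m≤n⇒m≤1+n (countIn-mono p q p⇒q xs)
... | false | false = countIn-mono p q p⇒q xs
... | true  | false with () ← trans (sym (p⇒q x px)) qx

count : ∀ {n} → (Fin n → Bool) → ℕ
count {n} q = countIn q (allFin n)

count-suc : ∀ {n} (q : Fin (suc n) → Bool) →
            count q ≡ countIn q [ zero ] + count (q ∘ suc)
count-suc {n} q = trans (countIn-++ q [ zero ] (tabulate suc))
  (cong (countIn q [ zero ] +_)
        (trans (cong (countIn q) (sym (LP.map-tabulate id suc))) (countIn-map q suc (allFin n))))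

count-none : ∀ {n} (q : Fin n → Bool) → (∀ x → q x ≡ false) → count q ≡ 0
count-none {zero}  q none = refl
count-none {suc n} q none rewrite count-suc q | none zero = count-none (q ∘ suc) (none ∘ suc)

≤-foldr-⊔ : ∀ {a} {A : Set a} (f : A → ℕ) {x xs} → x ∈ xs → f x ≤ foldr _⊔_ 0 (map f xs)
≤-foldr-⊔ f (here refl) = ℕP.m≤m⊔n _ _
≤-foldr-⊔ f (there x∈)  = ℕP.≤-trans (≤-foldr-⊔ f x∈) (ℕP.m≤n⊔m _ _)

allVecs : (n : ℕ) → List (Vec Bool n)
allVecs zero    = [ [] ]
allVecs (suc n) = map (true ∷_) (allVecs n) ++ map (false ∷_) (allVecs n)

∈-allVecs : ∀ {n} (β : Vec Bool n) → β ∈ allVecs n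
∈-allVecs []          = here refl
∈-allVecs (true  ∷ β) = ∈-++⁺ˡ (∈-map⁺ (true ∷_) (∈-allVecs β))
∈-allVecs (false ∷ β) = ∈-++⁺ʳ _ (∈-map⁺ (false ∷_) (∈-allVecs β))

supportedIn : ∀ {n} → (Fin n → Bool) → Vec Bool n → Bool
supportedIn q []      = true
supportedIn q (b ∷ β) = (q zero ∨ not b) ∧ supportedIn (q ∘ suc) β

record Supported {n} (q : Fin n → Bool) (β : Vec Bool n) : Set where
  constructor supported
  field marked : ∀ x → lookup β x ≡ true → q x ≡ true
open Supported public

supportedIn-sound : ∀ {n} (q : Fin n → Bool) β → supportedIn q β ≡ true → Supported q β
supportedIn-sound q β s = supported (sound q β s)
  where
  sound : ∀ {n} (q : Fin n → Bool) β → supportedIn q β ≡ true → ∀ x → lookup β x ≡ true → q x ≡ true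
  sound q (b ∷ β) s x βx with q zero in q₀ | b | x
  ... | true  | _     | zero  = q₀
  ... | true  | _     | suc x = sound (q ∘ suc) β s x βx
  ... | false | false | suc x = sound (q ∘ suc) β s x βx

supportedIn-complete : ∀ {n} (q : Fin n → Bool) β → Supported q β → supportedIn q β ≡ true
supportedIn-complete q []      s = refl
supportedIn-complete q (b ∷ β) s with q zero in q₀ | b
... | true  | _     = supportedIn-complete (q ∘ suc) β (supported (marked s ∘ suc))
... | false | false = supportedIn-complete (q ∘ suc) β (supported (marked s ∘ suc))
... | false | true  with () ← trans (sym (marked s zero refl)) q₀

-- Exactly 2 ^ (count q) vectors are supported in q: one free bit per position of q.
countIn-supported : ∀ {n} (q : Fin n → Bool) →
                    countIn (supportedIn q) (allVecs n) ≡ 2 ^ count q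
countIn-supported {zero}  q = refl
countIn-supported {suc n} q
  rewrite countIn-++ (supportedIn q) (map (true ∷_) (allVecs n)) (map (false ∷_) (allVecs n))
        | countIn-map (supportedIn q) (true ∷_) (allVecs n)
        | countIn-map (supportedIn q) (false ∷_) (allVecs n)
        | count-suc q
  with q zero
... | true  = cong₂ _+_ ih (trans ih (sym (ℕP.+-identityʳ _)))
  where ih : countIn (supportedIn (q ∘ suc)) (allVecs n) ≡ 2 ^ count (q ∘ suc)
        ih = countIn-supported (q ∘ suc)
... | false = trans (cong (_+ countIn (supportedIn (q ∘ suc)) (allVecs n)) (countIn-none (allVecs n)))
                    (countIn-supported (q ∘ suc))

_∪｛_｝ : ∀ {m} → (Fin m → Bool) → Fin m → Fin m → Bool
(U ∪｛ j ｝) x = U x ∨ does (x ≟ j)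

∪-self : ∀ {m} (U : Fin m → Bool) j → (U ∪｛ j ｝) j ≡ true
∪-self U j = trans (cong (U j ∨_) (dec-true (j ≟ j) refl)) (∨-zeroʳ (U j))

∪-other : ∀ {m} (U : Fin m → Bool) {j x} → x ≢ j → (U ∪｛ j ｝) x ≡ U x
∪-other U {j} {x} x≢j = trans (cong (U x ∨_) (dec-false (x ≟ j) x≢j)) (∨-identityʳ (U x))

⌊⌋-true : ∀ {p} {P : Set p} (d : Dec P) → P → ⌊ d ⌋ ≡ true
⌊⌋-true d x = trans (isYes≗does d) (dec-true d x)

⌊⌋-false : ∀ {p} {P : Set p} (d : Dec P) → ¬ P → ⌊ d ⌋ ≡ false
⌊⌋-false d ¬x = trans (isYes≗does d) (dec-false d ¬x)

does⇒ : ∀ {p} {P : Set p} (d : Dec P) → does d ≡ true → P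
does⇒ (yes x) _  = x
does⇒ (no  _) ()

Injective : ∀ {k m} → (Fin k → Fin m) → Set
Injective f = ∀ i j → f i ≡ f j → i ≡ j

injective-suc : ∀ {k m} (f : Fin (suc k) → Fin m) →
                Injective f ⇔ (Injective (f ∘ suc) × (∀ i → f (suc i) ≢ f zero))
injective-suc f = mk⇔ to from
  where
  to : Injective f → Injective (f ∘ suc) × (∀ i → f (suc i) ≢ f zero)
  to inj = (λ i j e → FinP.suc-injective (inj (suc i) (suc j) e)) , (λ i e → 0≢1+n (sym (inj (suc i) zero e)))
  from : Injective (f ∘ suc) × (∀ i → f (suc i) ≢ f zero) → Injective f
  from (inj , new) zero    zero    e = refl
  from (inj , new) zero    (suc j) e = ⊥-elim (new j (sym e))
  from (inj , new) (suc i) zero    e = ⊥-elim (new i e)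
  from (inj , new) (suc i) (suc j) e = cong suc (inj i j e)

T-injective : ∀ {a b} → (T a ⇔ T b) → a ≡ b
T-injective {true}  {true}  _ = refl
T-injective {false} {false} _ = refl
T-injective {true}  {false} h = ⊥-elim (Equivalence.to h tt)
T-injective {false} {true}  h = ⊥-elim (Equivalence.from h tt)

and-tabulate : ∀ {n} (p : Fin n → Bool) → T (and (tabulate p)) ⇔ (∀ i → T (p i))
and-tabulate {zero}  p = mk⇔ (λ _ ()) (λ _ → tt)
and-tabulate {suc n} p = mk⇔ to from
  where
  ih : T (and (tabulate (p ∘ suc))) ⇔ (∀ i → T (p (suc i)))
  ih = and-tabulate (p ∘ suc)
  to : T (p zero ∧ and (tabulate (p ∘ suc))) → ∀ i → T (p i)
  to h zero    = proj₁ (Equivalence.to T-∧ h)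
  to h (suc i) = Equivalence.to ih (proj₂ (Equivalence.to T-∧ h)) i
  from : (∀ i → T (p i)) → T (p zero ∧ and (tabulate (p ∘ suc)))
  from h = Equivalence.from T-∧ (h zero , Equivalence.from ih (h ∘ suc))

all-allFin : ∀ {n} (p : Fin n → Bool) → T (all p (allFin n)) ⇔ (∀ i → T (p i))
all-allFin {n} p = subst (λ bs → T (and bs) ⇔ (∀ i → T (p i))) (sym (LP.map-tabulate id p)) (and-tabulate p)

fresh : ∀ {k m} → (Fin m → Bool) → (Fin k → Fin m) → Bool
fresh {zero}  U f = true
fresh {suc k} U f = not (U (f zero)) ∧ fresh (U ∪｛ f zero ｝) (f ∘ suc)

fresh-spec : ∀ {k m} (U : Fin m → Bool) (f : Fin k → Fin m) →
             T (fresh U f) ⇔ (Injective f × (∀ i → T (not (U (f i)))))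
fresh-spec {zero}  U f = mk⇔ (λ _ → (λ ()) , (λ ())) (λ _ → tt)
fresh-spec {suc k} {m} U f = mk⇔ to from
  where
  f₀ : Fin m
  f₀ = f zero
  ih : T (fresh (U ∪｛ f₀ ｝) (f ∘ suc)) ⇔ (Injective (f ∘ suc) × (∀ i → T (not ((U ∪｛ f₀ ｝) (f (suc i))))))
  ih = fresh-spec (U ∪｛ f₀ ｝) (f ∘ suc)
  avoid : ∀ x → T (not ((U ∪｛ f₀ ｝) x)) ⇔ (T (not (U x)) × x ≢ f₀)
  avoid x with U x | x ≟ f₀
  ... | true  | _      = mk⇔ (λ ()) (λ ())
  ... | false | yes e  = mk⇔ (λ ()) (λ (_ , ne) → ne e)
  ... | false | no  ne = mk⇔ (λ _ → tt , ne) (λ _ → tt)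
  to : T (fresh U f) → Injective f × (∀ i → T (not (U (f i))))
  to h with Equivalence.to T-∧ h
  ... | u₀ , rest with Equivalence.to ih rest
  ...   | inj , av = Equivalence.from (injective-suc f) (inj , λ i → proj₂ (Equivalence.to (avoid _) (av i)))
                   , λ { zero → u₀ ; (suc i) → proj₁ (Equivalence.to (avoid _) (av i)) }
  from : Injective f × (∀ i → T (not (U (f i)))) → T (fresh U f)
  from (inj , av) with Equivalence.to (injective-suc f) inj
  ... | inj′ , new = Equivalence.from T-∧
        (av zero , Equivalence.from ih (inj′ , λ i → Equivalence.from (avoid _) (av (suc i) , new i)))

module Involution {n} (π : Fin n → Fin n) (π-invol : ∀ x → π (π x) ≡ x) where

  -- x is the smaller end of a 2-cycle cut by layer i: row x lies before i, row π x does not.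
  Open : ℕ → Fin n → Set
  Open i x = toℕ x < toℕ (π x) × toℕ x < i × i ≤ toℕ (π x)

  open? : ∀ i x → Dec (Open i x)
  open? i x = toℕ x ℕP.<? toℕ (π x) ×-dec toℕ x ℕP.<? i ×-dec i ℕP.≤? toℕ (π x)

  isOpen : ℕ → Fin n → Bool
  isOpen i x = does (open? i x)

  before : ℕ → Fin n → Bool
  before i x = does (toℕ x <? i)

  -- A state at layer i is a vector β with β x = true for some open x only, meaning
  -- that row x took column π x.  The columns used by the rows before layer i:
  used : ℕ → Vec Bool n → Fin n → Bool
  used i β x = if isOpen i x then not (lookup β x)
               else if isOpen i (π x) then lookup β (π x)
               else before i x

  -- Moves at row v: the column taken by row v together with the new state.
  moves : Fin n → Vec Bool n → List (Fin n × Vec Bool n)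
  moves v β with π v ≟ v | toℕ v <? toℕ (π v) | lookup β (π v)
  ... | yes _ | _     | _     = [ (v , β) ]
  ... | no  _ | yes _ | _     = (v , β) ∷ (π v , β [ v ]≔ true) ∷ []
  ... | no  _ | no  _ | true  = [ (π v , β [ π v ]≔ false) ]
  ... | no  _ | no  _ | false = [ (v , β [ π v ]≔ false) ]

  module Row {i} (i<n : i < n) where

    v p : Fin n
    v = fromℕ< i<n
    p = π v

    toℕ-v : toℕ v ≡ i
    toℕ-v = FinP.toℕ-fromℕ< i<n

    π-p : π p ≡ v
    π-p = π-invol v

    Away : Fin n → Set
    Away x = x ≢ v × x ≢ p

    away-π : ∀ {x} → Away x → Away (π x)
    away-π {x} (x≢v , x≢p) = (λ e → x≢p (trans (sym (π-invol x)) (cong π e)))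
                            , (λ e → x≢v (trans (sym (π-invol x)) (trans (cong π e) π-p)))

    ≢i : ∀ {x} → x ≢ v → toℕ x ≢ i
    ≢i x≢v e = x≢v (FinP.toℕ-injective (trans e (sym toℕ-v)))

    isOpen-stable : ∀ {x} → toℕ x ≢ i → toℕ (π x) ≢ i → isOpen (suc i) x ≡ isOpen i x
    isOpen-stable x≢ πx≢ = does-⇔
      (mk⇔ (λ (a , b , c) → a , ℕP.≤∧≢⇒< (ℕP.≤-pred b) x≢ , ℕP.<⇒≤ c)
           (λ (a , b , c) → a , ℕP.m<n⇒m<1+n b , ℕP.≤∧≢⇒< c (πx≢ ∘ sym)))
      (open? (suc i) _) (open? i _)

    before-stable : ∀ {x} → toℕ x ≢ i → before (suc i) x ≡ before i x
    before-stable x≢ = does-⇔ (mk⇔ (λ b → ℕP.≤∧≢⇒< (ℕP.≤-pred b) x≢) ℕP.m<n⇒m<1+n) (_ <? suc i) (_ <? i)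

    record Agree (β β′ : Vec Bool n) : Set where
      constructor agreeing
      field away : ∀ {y} → Away y → lookup β′ y ≡ lookup β y

    agree-refl : ∀ β → Agree β β
    agree-refl β = agreeing (λ _ → refl)

    used-away : ∀ {β β′} → Agree β β′ → ∀ {x} → Away x → used (suc i) β′ x ≡ used i β x
    used-away agree {x} ax@(x≢v , _)
      rewrite isOpen-stable (≢i x≢v) (≢i (proj₁ (away-π ax)))
            | isOpen-stable (≢i (proj₁ (away-π ax))) (subst (λ y → toℕ y ≢ i) (sym (π-invol x)) (≢i x≢v))
            | before-stable (≢i x≢v) | Agree.away agree ax | Agree.away agree (away-π ax) = refl

    used-after : ∀ {β β′ j} → Agree β β′ → j ≡ v ⊎ j ≡ p →
                 used (suc i) β′ v ≡ (used i β ∪｛ j ｝) v → used (suc i) β′ p ≡ (used i β ∪｛ j ｝) p →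
                 ∀ x → used (suc i) β′ x ≡ (used i β ∪｛ j ｝) x
    used-after {β} agree j∈ at-v at-p x with x ≟ v | x ≟ p
    ... | yes refl | _        = at-v
    ... | no  _    | yes refl = at-p
    ... | no  x≢v  | no  x≢p  =
      trans (used-away agree (x≢v , x≢p)) (sym (trans (cong (used i β x ∨_) (x≢j j∈)) (∨-identityʳ _)))
      where x≢j : ∀ {j} → j ≡ v ⊎ j ≡ p → does (x ≟ j) ≡ false
            x≢j (inj₁ refl) = dec-false (x ≟ v) x≢v
            x≢j (inj₂ refl) = dec-false (x ≟ p) x≢p

    supported-after : ∀ {β β′} → Supported (isOpen i) β → Agree β β′ →
                      (lookup β′ v ≡ true → isOpen (suc i) v ≡ true) →
                      (lookup β′ p ≡ true → isOpen (suc i) p ≡ true) →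
                      Supported (isOpen (suc i)) β′
    supported-after {β′ = β′} sβ agree at-v at-p = supported marked′
      where
      marked′ : ∀ x → lookup β′ x ≡ true → isOpen (suc i) x ≡ true
      marked′ x with x ≟ v | x ≟ p
      ... | yes refl | _        = at-v
      ... | no  _    | yes refl = at-p
      ... | no  x≢v  | no  x≢p  = λ t → trans (isOpen-stable (≢i x≢v) (≢i (proj₁ (away-π (x≢v , x≢p)))))
                                              (marked sβ x (trans (sym (Agree.away agree (x≢v , x≢p))) t))

    v-not-open : isOpen i v ≡ false
    v-not-open = dec-false (open? i v) (λ (_ , v<i , _) → ℕP.<-irrefl toℕ-v v<i)

    v-not-before : before i v ≡ false
    v-not-before = dec-false (_ <? i) (ℕP.<-irrefl toℕ-v)

    v-before-next : before (suc i) v ≡ true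
    v-before-next = dec-true (_ <? suc i) (s≤s (ℕP.≤-reflexive toℕ-v))

    unmarked-v : ∀ {β} → Supported (isOpen i) β → lookup β v ≡ false
    unmarked-v {β} sβ with lookup β v in e
    ... | false = refl
    ... | true  with () ← trans (sym (marked sβ v e)) v-not-open

    record Legal (β : Vec Bool n) (m : Fin n × Vec Bool n) : Set where
      field
        free   : used i β (proj₁ m) ≡ false
        update : ∀ x → used (suc i) (proj₂ m) x ≡ (used i β ∪｛ proj₁ m ｝) x
        next   : Supported (isOpen (suc i)) (proj₂ m)

    -- v is a fixed point of π: row v must take column v, the state is unchanged.
    module SelfLoop (p≡v : p ≡ v) where

      v-not-open-next : isOpen (suc i) v ≡ false
      v-not-open-next = dec-false (open? (suc i) v) (λ (a , _) → ℕP.<-irrefl (cong toℕ (sym p≡v)) a)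

      free-v : ∀ β → used i β v ≡ false
      free-v β rewrite v-not-open | p≡v | v-not-open | v-not-before = refl

      used-next-v : ∀ β → used (suc i) β v ≡ true
      used-next-v β rewrite v-not-open-next | p≡v | v-not-open-next | v-before-next = refl

      legal : ∀ {β} → Supported (isOpen i) β → Legal β (v , β)
      legal {β} sβ = record
        { free   = free-v β
        ; update = used-after (agree-refl β) (inj₁ refl) at-v
                     (subst (λ y → used (suc i) β y ≡ (used i β ∪｛ v ｝) y) (sym p≡v) at-v)
        ; next   = supported-after sβ (agree-refl β) marked-v
                     (subst (λ y → lookup β y ≡ true → isOpen (suc i) y ≡ true) (sym p≡v) marked-v)
        }
        where
        at-v : used (suc i) β v ≡ (used i β ∪｛ v ｝) v
        at-v = trans (used-next-v β) (sym (∪-self (used i β) v))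
        marked-v : lookup β v ≡ true → isOpen (suc i) v ≡ true
        marked-v t with () ← trans (sym t) (unmarked-v sβ)

    -- v < p: the 2-cycle (v p) opens; row v takes column v or column p (recorded in β at v).
    module Opening (v<p : toℕ v < toℕ p) where

      v≢p : v ≢ p
      v≢p e = ℕP.<-irrefl (cong toℕ e) v<p

      i<p : i < toℕ p
      i<p = subst (_< toℕ p) toℕ-v v<p

      p-not-open : isOpen i p ≡ false
      p-not-open = dec-false (open? i p) (λ (_ , p<i , _) → ℕP.<-asym i<p p<i)

      p-not-before : before i p ≡ false
      p-not-before = dec-false (_ <? i) (ℕP.<-asym i<p)

      v-open-next : isOpen (suc i) v ≡ true
      v-open-next = dec-true (open? (suc i) v) (v<p , s≤s (ℕP.≤-reflexive toℕ-v) , i<p)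

      p-not-open-next : isOpen (suc i) p ≡ false
      p-not-open-next = dec-false (open? (suc i) p) (λ (a , _) → ℕP.<-asym v<p (subst (λ y → toℕ p < toℕ y) π-p a))

      free-v : ∀ β → used i β v ≡ false
      free-v β rewrite v-not-open | p-not-open | v-not-before = refl

      free-p : ∀ β → used i β p ≡ false
      free-p β rewrite p-not-open | π-p | v-not-open | p-not-before = refl

      used-next-v : ∀ β′ → used (suc i) β′ v ≡ not (lookup β′ v)
      used-next-v β′ rewrite v-open-next = refl

      used-next-p : ∀ β′ → used (suc i) β′ p ≡ lookup β′ v
      used-next-p β′ rewrite p-not-open-next | π-p | v-open-next = refl

      unmarked-p : ∀ {β} → Supported (isOpen i) β → lookup β p ≡ true → isOpen (suc i) p ≡ true
      unmarked-p sβ t with () ← trans (sym (marked sβ p t)) p-not-open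

      legal-keep : ∀ {β} → Supported (isOpen i) β → Legal β (v , β)
      legal-keep {β} sβ = record
        { free   = free-v β
        ; update = used-after (agree-refl β) (inj₁ refl) at-v at-p
        ; next   = supported-after sβ (agree-refl β) (λ _ → v-open-next) (unmarked-p sβ)
        }
        where
        at-v : used (suc i) β v ≡ (used i β ∪｛ v ｝) v
        at-v = trans (used-next-v β) (trans (cong not (unmarked-v sβ)) (sym (∪-self (used i β) v)))
        at-p : used (suc i) β p ≡ (used i β ∪｛ v ｝) p
        at-p = trans (used-next-p β) (trans (unmarked-v sβ)
                 (sym (trans (∪-other (used i β) (v≢p ∘ sym)) (free-p β))))

      legal-swap : ∀ {β} → Supported (isOpen i) β → Legal β (p , β [ v ]≔ true)
      legal-swap {β} sβ = record
        { free   = free-p β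
        ; update = used-after agree (inj₂ refl) at-v at-p
        ; next   = supported-after sβ agree (λ _ → v-open-next)
                     (unmarked-p sβ ∘ trans (sym (VecP.lookup∘update′ (v≢p ∘ sym) β true)))
        }
        where
        β′ : Vec Bool n
        β′ = β [ v ]≔ true
        agree : Agree β β′
        agree = agreeing λ (y≢v , _) → VecP.lookup∘update′ y≢v β true
        at-v : used (suc i) β′ v ≡ (used i β ∪｛ p ｝) v
        at-v = trans (used-next-v β′) (trans (cong not (VecP.lookup∘update v β true))
                 (sym (trans (∪-other (used i β) v≢p) (free-v β))))
        at-p : used (suc i) β′ p ≡ (used i β ∪｛ p ｝) p
        at-p = trans (used-next-p β′) (trans (VecP.lookup∘update v β true) (sym (∪-self (used i β) p)))

    -- p < v: the 2-cycle (p v) closes; row v takes whichever of v, p row p left free.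
    module Closing (p<v : toℕ p < toℕ v) where

      p≢v : p ≢ v
      p≢v e = ℕP.<-irrefl (cong toℕ e) p<v

      p<i : toℕ p < i
      p<i = subst (toℕ p <_) toℕ-v p<v

      p-open : isOpen i p ≡ true
      p-open = dec-true (open? i p)
        ( subst (λ y → toℕ p < toℕ y) (sym π-p) p<v , p<i
        , subst (λ y → i ≤ toℕ y) (sym π-p) (ℕP.≤-reflexive (sym toℕ-v)))

      v-not-open-next : isOpen (suc i) v ≡ false
      v-not-open-next = dec-false (open? (suc i) v) (λ (a , _) → ℕP.<-asym p<v a)

      p-not-open-next : isOpen (suc i) p ≡ false
      p-not-open-next = dec-false (open? (suc i) p)
        (λ (_ , _ , c) → ℕP.<-irrefl (sym toℕ-v) (subst (λ y → suc i ≤ toℕ y) π-p c))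

      p-before-next : before (suc i) p ≡ true
      p-before-next = dec-true (_ <? suc i) (ℕP.m<n⇒m<1+n p<i)

      used-v : ∀ β → used i β v ≡ lookup β p
      used-v β rewrite v-not-open | p-open = refl

      used-p : ∀ β → used i β p ≡ not (lookup β p)
      used-p β rewrite p-open = refl

      used-next-v : ∀ β′ → used (suc i) β′ v ≡ true
      used-next-v β′ rewrite v-not-open-next | p-not-open-next | v-before-next = refl

      used-next-p : ∀ β′ → used (suc i) β′ p ≡ true
      used-next-p β′ rewrite p-not-open-next | π-p | v-not-open-next | p-before-next = refl

      -- after closing, the 2-cycle is forgotten
      cleared : Vec Bool n → Vec Bool n
      cleared β = β [ p ]≔ false

      agree : ∀ {β} → Agree β (cleared β)
      agree {β} = agreeing λ (_ , y≢p) → VecP.lookup∘update′ y≢p β false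

      next : ∀ {β} → Supported (isOpen i) β → Supported (isOpen (suc i)) (cleared β)
      next {β} sβ = supported-after sβ agree
        (λ t → true≢false (trans (sym t) (trans (VecP.lookup∘update′ (p≢v ∘ sym) β false) (unmarked-v sβ))))
        (λ t → true≢false (trans (sym t) (VecP.lookup∘update p β false)))
        where true≢false : ∀ {A : Set} → true ≡ false → A
              true≢false ()

      -- row p took column v: row v takes column p
      legal-p : ∀ {β} → Supported (isOpen i) β → lookup β p ≡ true → Legal β (p , cleared β)
      legal-p {β} sβ βp = record
        { free   = trans (used-p β) (cong not βp)
        ; update = used-after (agree {β}) (inj₂ refl)
                     (trans (used-next-v (cleared β))
                            (sym (trans (∪-other (used i β) (p≢v ∘ sym)) (trans (used-v β) βp))))
                     (trans (used-next-p (cleared β)) (sym (∪-self (used i β) p)))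
        ; next   = next sβ
        }

      -- row p kept column p: row v takes column v
      legal-v : ∀ {β} → Supported (isOpen i) β → lookup β p ≡ false → Legal β (v , cleared β)
      legal-v {β} sβ βp = record
        { free   = trans (used-v β) βp
        ; update = used-after (agree {β}) (inj₁ refl)
                     (trans (used-next-v (cleared β)) (sym (∪-self (used i β) v)))
                     (trans (used-next-p (cleared β))
                            (sym (trans (∪-other (used i β) p≢v) (trans (used-p β) (cong not βp)))))
        ; next   = next sβ
        }

    partner<v : π v ≢ v → ¬ (toℕ v < toℕ (π v)) → toℕ (π v) < toℕ v
    partner<v p≢v v≮p = ℕP.≤∧≢⇒< (ℕP.≮⇒≥ v≮p) (p≢v ∘ FinP.toℕ-injective)

    moves-legal : ∀ {β} → Supported (isOpen i) β → All (Legal β) (moves v β)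
    moves-legal {β} sβ with π v ≟ v | toℕ v <? toℕ (π v) | lookup β (π v) in βp
    ... | yes p≡v | _       | _     = SelfLoop.legal p≡v sβ ∷ []
    ... | no  _   | yes v<p | _     = Opening.legal-keep v<p sβ ∷ Opening.legal-swap v<p sβ ∷ []
    ... | no  p≢v | no  v≮p | true  = Closing.legal-p (partner<v p≢v v≮p) sβ βp ∷ []
    ... | no  p≢v | no  v≮p | false = Closing.legal-v (partner<v p≢v v≮p) sβ βp ∷ []

    moves-next : ∀ {β} → Supported (isOpen i) β → All (λ m → Supported (isOpen (suc i)) (proj₂ m)) (moves v β)
    moves-next sβ = All.map Legal.next (moves-legal sβ)

module Construction {a ℓa r ℓr} (K : Field a ℓa) (𝓡 : Algebra K r ℓr) where
  open Over K 𝓡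
  open Algebra 𝓡 using (0#; 1#) renaming (-_ to -ᴿ_)

  𝟘 𝟙 : Poly
  𝟘 = C 0#
  𝟙 = C 1#

  ≃-setoid : Setoid _ _
  ≃-setoid = record { Carrier = Poly ; _≈_ = _≃_
    ; isEquivalence = record { refl = ≃-refl ; sym = ≃-sym ; trans = ≃-trans } }

  open import Relation.Binary.Reasoning.Setoid ≃-setoid

  ≡⇒≃ : ∀ {p q} → p ≡ q → p ≃ q
  ≡⇒≃ refl = ≃-refl

  ⊕-idʳ : ∀ p → p ⊕ 𝟘 ≃ p
  ⊕-idʳ p = ≃-trans (⊕-comm p 𝟘) (⊕-idˡ p)

  idempotent⇒zero : ∀ x → x ⊕ x ≃ x → x ≃ 𝟘
  idempotent⇒zero x h = begin
    x                          ≈⟨ ≃-sym (⊕-idʳ x) ⟩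
    x ⊕ 𝟘                      ≈⟨ ⊕-cong ≃-refl (≃-sym (⊕-invʳ x)) ⟩
    x ⊕ (x ⊕ C (-ᴿ 1#) ⊗ x)    ≈⟨ ≃-sym (⊕-assoc x x _) ⟩
    (x ⊕ x) ⊕ C (-ᴿ 1#) ⊗ x    ≈⟨ ⊕-cong h ≃-refl ⟩
    x ⊕ C (-ᴿ 1#) ⊗ x          ≈⟨ ⊕-invʳ x ⟩
    𝟘                          ∎

  ⊗-zeroʳ : ∀ p → p ⊗ 𝟘 ≃ 𝟘
  ⊗-zeroʳ p = idempotent⇒zero (p ⊗ 𝟘)
    (≃-trans (≃-sym (distribˡ p 𝟘 𝟘)) (⊗-cong ≃-refl (⊕-idˡ 𝟘)))

  ⊗-zeroˡ : ∀ p → 𝟘 ⊗ p ≃ 𝟘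
  ⊗-zeroˡ p = idempotent⇒zero (𝟘 ⊗ p)
    (≃-trans (≃-sym (distribʳ p 𝟘 𝟘)) (⊗-cong (⊕-idˡ 𝟘) ≃-refl))

  ⊕-interchange : ∀ p q s t → (p ⊕ q) ⊕ (s ⊕ t) ≃ (p ⊕ s) ⊕ (q ⊕ t)
  ⊕-interchange p q s t = begin
    (p ⊕ q) ⊕ (s ⊕ t)   ≈⟨ ⊕-assoc p q (s ⊕ t) ⟩
    p ⊕ (q ⊕ (s ⊕ t))   ≈⟨ ⊕-cong ≃-refl (≃-sym (⊕-assoc q s t)) ⟩
    p ⊕ ((q ⊕ s) ⊕ t)   ≈⟨ ⊕-cong ≃-refl (⊕-cong (⊕-comm q s) ≃-refl) ⟩
    p ⊕ ((s ⊕ q) ⊕ t)   ≈⟨ ⊕-cong ≃-refl (⊕-assoc s q t) ⟩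
    p ⊕ (s ⊕ (q ⊕ t))   ≈⟨ ≃-sym (⊕-assoc p s (q ⊕ t)) ⟩
    (p ⊕ s) ⊕ (q ⊕ t)   ∎

  _when_ : Poly → Bool → Poly
  p when b = if b then p else 𝟘

  when-cong : ∀ {p q} b → p ≃ q → p when b ≃ q when b
  when-cong true  p≃q = p≃q
  when-cong false p≃q = ≃-refl

  𝟘-when : ∀ b → 𝟘 when b ≃ 𝟘
  𝟘-when true  = ≃-refl
  𝟘-when false = ≃-refl

  ⊗-when : ∀ p q b → p ⊗ (q when b) ≃ (p ⊗ q) when b
  ⊗-when p q true  = ≃-refl
  ⊗-when p q false = ⊗-zeroʳ p

  private variable
    ℓ ℓ′ : Level
    A : Set ℓ
    B : Set ℓ′

  Σ : (A → Poly) → List A → Poly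
  Σ f xs = ΣP (map f xs)

  Σ-cong : ∀ {f g : A → Poly} xs → (∀ x → f x ≃ g x) → Σ f xs ≃ Σ g xs
  Σ-cong []       fg = ≃-refl
  Σ-cong (x ∷ xs) fg = ⊕-cong (fg x) (Σ-cong xs fg)

  Σ-congᴬ : ∀ {p} {P : A → Set p} {f g : A → Poly} {xs} → All P xs →
          (∀ {x} → P x → f x ≃ g x) → Σ f xs ≃ Σ g xs
  Σ-congᴬ []         fg = ≃-refl
  Σ-congᴬ (px ∷ pxs) fg = ⊕-cong (fg px) (Σ-congᴬ pxs fg)

  Σ-zero : ∀ {f : A → Poly} xs → (∀ x → f x ≃ 𝟘) → Σ f xs ≃ 𝟘
  Σ-zero []       z = ≃-refl
  Σ-zero (x ∷ xs) z = ≃-trans (⊕-cong (z x) (Σ-zero xs z)) (⊕-idˡ 𝟘)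

  Σ-++ : ∀ (f : A → Poly) xs ys → Σ f (xs ++ ys) ≃ Σ f xs ⊕ Σ f ys
  Σ-++ f []       ys = ≃-sym (⊕-idˡ _)
  Σ-++ f (x ∷ xs) ys = ≃-trans (⊕-cong ≃-refl (Σ-++ f xs ys)) (≃-sym (⊕-assoc _ _ _))

  Σ-⊕ : ∀ (f g : A → Poly) xs → Σ (λ x → f x ⊕ g x) xs ≃ Σ f xs ⊕ Σ g xs
  Σ-⊕ f g []       = ≃-sym (⊕-idˡ 𝟘)
  Σ-⊕ f g (x ∷ xs) = ≃-trans (⊕-cong ≃-refl (Σ-⊕ f g xs)) (⊕-interchange _ _ _ _)

  Σ-⊗ˡ : ∀ p (f : A → Poly) xs → p ⊗ Σ f xs ≃ Σ (λ x → p ⊗ f x) xs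
  Σ-⊗ˡ p f []       = ⊗-zeroʳ p
  Σ-⊗ˡ p f (x ∷ xs) = ≃-trans (distribˡ p _ _) (⊕-cong ≃-refl (Σ-⊗ˡ p f xs))

  Σ-filter : ∀ (f : A → Poly) (p : A → Bool) xs → Σ f (filterᵇ p xs) ≃ Σ (λ x → f x when p x) xs
  Σ-filter f p []       = ≃-refl
  Σ-filter f p (x ∷ xs) with p x
  ... | true  = ⊕-cong ≃-refl (Σ-filter f p xs)
  ... | false = ≃-trans (Σ-filter f p xs) (≃-sym (⊕-idˡ _))

  Σ-map : ∀ (f : B → Poly) (g : A → B) xs → Σ f (map g xs) ≡ Σ (f ∘ g) xs
  Σ-map f g xs = cong ΣP (sym (LP.map-∘ xs))

  Σ-concatMap : ∀ (f : B → Poly) (h : A → List B) xs →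
                Σ f (concatMap h xs) ≃ Σ (λ x → Σ f (h x)) xs
  Σ-concatMap f h []       = ≃-refl
  Σ-concatMap f h (x ∷ xs) = ≃-trans (Σ-++ f (h x) (concatMap h xs)) (⊕-cong ≃-refl (Σ-concatMap f h xs))

  Σ-swap : ∀ (f : A → B → Poly) xs ys →
           Σ (λ x → Σ (f x) ys) xs ≃ Σ (λ y → Σ (λ x → f x y) xs) ys
  Σ-swap f []       ys = ≃-sym (Σ-zero ys (λ _ → ≃-refl))
  Σ-swap f (x ∷ xs) ys = ≃-trans (⊕-cong ≃-refl (Σ-swap f xs ys)) (≃-sym (Σ-⊕ (f x) _ ys))

  Σ-allFin-suc : ∀ {m} (h : Fin (suc m) → Poly) → Σ h (allFin (suc m)) ≡ h zero ⊕ Σ (h ∘ suc) (allFin m)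
  Σ-allFin-suc h = cong (λ hs → h zero ⊕ ΣP hs)
    (trans (LP.map-tabulate suc h) (sym (LP.map-tabulate id (h ∘ suc))))

  Σ-δ : ∀ {m} (h : Fin m → Poly) a → (∀ j → j ≢ a → h j ≃ 𝟘) → Σ h (allFin m) ≃ h a
  Σ-δ {suc m} h zero    z = begin
    Σ h (allFin (suc m))            ≡⟨ Σ-allFin-suc h ⟩
    h zero ⊕ Σ (h ∘ suc) (allFin m) ≈⟨ ⊕-cong ≃-refl (Σ-zero (allFin m) (λ j → z (suc j) (0≢1+n ∘ sym))) ⟩
    h zero ⊕ 𝟘                      ≈⟨ ⊕-idʳ _ ⟩
    h zero                          ∎
  Σ-δ {suc m} h (suc a) z = begin
    Σ h (allFin (suc m))            ≡⟨ Σ-allFin-suc h ⟩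
    h zero ⊕ Σ (h ∘ suc) (allFin m) ≈⟨ ⊕-cong (z zero 0≢1+n)
                                               (Σ-δ (h ∘ suc) a (λ j ne → z (suc j) (ne ∘ FinP.suc-injective))) ⟩
    𝟘 ⊕ h (suc a)                   ≈⟨ ⊕-idˡ _ ⟩
    h (suc a)                       ∎

  Σ-δ₂ : ∀ {m} (h : Fin m → Poly) a b → a ≢ b → (∀ j → j ≢ a → j ≢ b → h j ≃ 𝟘) →
         Σ h (allFin m) ≃ h a ⊕ h b
  Σ-δ₂ {suc m} h zero    zero    a≢b z = ⊥-elim (a≢b refl)
  Σ-δ₂ {suc m} h zero    (suc b) a≢b z = ≃-trans (≡⇒≃ (Σ-allFin-suc h))
    (⊕-cong ≃-refl (Σ-δ (h ∘ suc) b (λ j ne → z (suc j) (0≢1+n ∘ sym) (ne ∘ FinP.suc-injective))))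
  Σ-δ₂ {suc m} h (suc a) zero    a≢b z = ≃-trans (≡⇒≃ (Σ-allFin-suc h))
    (≃-trans (⊕-cong ≃-refl (Σ-δ (h ∘ suc) a (λ j ne → z (suc j) (ne ∘ FinP.suc-injective) (0≢1+n ∘ sym))))
             (⊕-comm _ _))
  Σ-δ₂ {suc m} h (suc a) (suc b) a≢b z = ≃-trans (≡⇒≃ (Σ-allFin-suc h))
    (≃-trans (⊕-cong (z zero 0≢1+n 0≢1+n)
                     (Σ-δ₂ (h ∘ suc) a b (a≢b ∘ cong suc)
                           (λ j na nb → z (suc j) (na ∘ FinP.suc-injective) (nb ∘ FinP.suc-injective))))
             (⊕-idˡ _))

  Σ-when : ∀ b (f : A → Poly) xs → Σ (λ x → f x when b) xs ≃ Σ f xs when b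
  Σ-when true  f xs = ≃-refl
  Σ-when false f xs = Σ-zero xs (λ _ → ≃-refl)

  Σ-δ-upTo : ∀ (f : ℕ → Poly) n m → n < m → Σ (λ k → f k when (k ≡ᵇ n)) (upTo m) ≃ f n
  Σ-δ-upTo f n (suc m) n<m = ≃-trans (≡⇒≃ (cong (λ ks → f 0 when (0 ≡ᵇ n) ⊕ Σ (λ k → f k when (k ≡ᵇ n)) ks)
                                                (sym (LP.map-upTo suc m))))
                               (≃-trans (⊕-cong ≃-refl (≡⇒≃ (Σ-map _ suc (upTo m)))) (split n n<m))
    where
    split : ∀ n → n < suc m → f 0 when (0 ≡ᵇ n) ⊕ Σ (λ k → f (suc k) when (suc k ≡ᵇ n)) (upTo m) ≃ f n
    split zero    _         = ≃-trans (⊕-cong ≃-refl (Σ-zero (upTo m) (λ _ → ≃-refl))) (⊕-idʳ _)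
    split (suc n) (s≤s n<m) = ≃-trans (⊕-idˡ _) (Σ-δ-upTo (f ∘ suc) n m n<m)

  -- Row expansion of Σ_f Π_i W(i, f i) over injective f avoiding the used columns U,
  -- for the rows l, l+1, …, l+k-1 (row i has weight W i).
  rowExpansion : ∀ {m} → (ℕ → Fin m → Poly) → ℕ → ℕ → (Fin m → Bool) → Poly
  rowExpansion     W zero    l U = 𝟙
  rowExpansion {m} W (suc k) l U =
    Σ (λ j → (W l j ⊗ rowExpansion W k (suc l) (U ∪｛ j ｝)) when not (U j)) (allFin m)

  rowExpansion-congᵁ : ∀ {m} (W : ℕ → Fin m → Poly) k l {U U′ : Fin m → Bool} →
                       (∀ x → U x ≡ U′ x) → rowExpansion W k l U ≃ rowExpansion W k l U′
  rowExpansion-congᵁ W zero    l U≗U′ = ≃-refl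
  rowExpansion-congᵁ W (suc k) l {U} {U′} U≗U′ = Σ-cong (allFin _) λ j →
    subst (λ b → _ when not (U j) ≃ _ when not b) (U≗U′ j)
      (when-cong (not (U j)) (⊗-cong ≃-refl
        (rowExpansion-congᵁ W k (suc l) (λ x → cong (_∨ does (x ≟ j)) (U≗U′ x)))))

  rowExpansion-shift : ∀ {m} (W : ℕ → Fin m → Poly) k l U →
                       rowExpansion (W ∘ suc) k l U ≃ rowExpansion W k (suc l) U
  rowExpansion-shift W zero    l U = ≃-refl
  rowExpansion-shift W (suc k) l U = Σ-cong (allFin _) λ j →
    when-cong (not (U j)) (⊗-cong ≃-refl (rowExpansion-shift W k (suc l) (U ∪｛ j ｝)))

  monomial : ∀ {k m} → (ℕ → Fin m → Poly) → (Fin k → Fin m) → Poly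
  monomial {k} W f = ΠP (map (λ i → W (toℕ i) (f i)) (allFin k))

  monomial-suc : ∀ {k m} (W : ℕ → Fin m → Poly) (g : Fin (suc k) → Fin m) →
                 monomial W g ≡ W 0 (g zero) ⊗ monomial (W ∘ suc) (g ∘ suc)
  monomial-suc {k} W g = cong (λ ws → W 0 (g zero) ⊗ ΠP ws)
    (trans (LP.map-tabulate suc h) (sym (LP.map-tabulate id (h ∘ suc))))
    where h : Fin (suc k) → Poly
          h i = W (toℕ i) (g i)

  summand : ∀ {k m} → (ℕ → Fin m → Poly) → (Fin m → Bool) → (Fin k → Fin m) → Poly
  summand W U f = monomial W f when fresh U f

  summand-suc : ∀ {k m} (W : ℕ → Fin m → Poly) U (g : Fin (suc k) → Fin m) →
                summand W U g ≃
                (W 0 (g zero) ⊗ summand (W ∘ suc) (U ∪｛ g zero ｝) (g ∘ suc)) when not (U (g zero))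
  summand-suc W U g rewrite monomial-suc W g with U (g zero) | fresh (U ∪｛ g zero ｝) (g ∘ suc)
  ... | true  | _     = ≃-refl
  ... | false | true  = ≃-refl
  ... | false | false = ≃-sym (⊗-zeroʳ _)

  Σ-prepend : ∀ {k m} (W : ℕ → Fin m → Poly) U (c : Fin m → (Fin k → Fin m) → Fin (suc k) → Fin m) →
              (∀ j f → c j f zero ≡ j) → ∀ fs →
              Σ (summand W U) (concatMap (λ f → map (λ j → c j f) (allFin m)) fs) ≃
              Σ (λ j → (W 0 j ⊗ Σ (λ f → summand (W ∘ suc) (U ∪｛ j ｝) (c j f ∘ suc)) fs) when not (U j))
                (allFin m)
  Σ-prepend {k} {m} W U c head fs = begin
    Σ (summand W U) (concatMap (λ f → map (λ j → c j f) (allFin m)) fs)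
      ≈⟨ Σ-concatMap (summand W U) _ fs ⟩
    Σ (λ f → Σ (summand W U) (map (λ j → c j f) (allFin m))) fs
      ≈⟨ Σ-cong fs (λ f → ≡⇒≃ (Σ-map (summand W U) (λ j → c j f) (allFin m))) ⟩
    Σ (λ f → Σ (λ j → summand W U (c j f)) (allFin m)) fs
      ≈⟨ Σ-swap (λ f j → summand W U (c j f)) fs (allFin m) ⟩
    Σ (λ j → Σ (λ f → summand W U (c j f)) fs) (allFin m)
      ≈⟨ Σ-cong (allFin m) (λ j → Σ-cong fs (expandHead j)) ⟩
    Σ (λ j → Σ (λ f → (W 0 j ⊗ tail j f) when not (U j)) fs) (allFin m)
      ≈⟨ Σ-cong (allFin m) (λ j → ≃-trans (Σ-when (not (U j)) _ fs)
                                  (when-cong (not (U j)) (≃-sym (Σ-⊗ˡ (W 0 j) (tail j) fs)))) ⟩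
    Σ (λ j → (W 0 j ⊗ Σ (tail j) fs) when not (U j)) (allFin m)
      ∎
    where
    tail : Fin m → (Fin k → Fin m) → Poly
    tail j f = summand (W ∘ suc) (U ∪｛ j ｝) (c j f ∘ suc)
    expandHead : ∀ j f → summand W U (c j f) ≃ (W 0 j ⊗ tail j f) when not (U j)
    expandHead j f = ≃-trans (summand-suc W U (c j f))
      (≡⇒≃ (cong (λ x → (W 0 x ⊗ summand (W ∘ suc) (U ∪｛ x ｝) (c j f ∘ suc)) when not (U x)) (head j f)))

  rowExpansion-sound : ∀ {m} k (W : ℕ → Fin m → Poly) U →
                       Σ (summand W U) (allFuns k m) ≃ rowExpansion W k 0 U
  rowExpansion-sound     zero    W U = ⊕-idʳ _
  rowExpansion-sound {m} (suc k) W U = ≃-trans (Σ-prepend W U _ (λ _ _ → refl) (allFuns k m))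
    (Σ-cong (allFin m) λ j → when-cong (not (U j)) (⊗-cong ≃-refl
      (≃-trans (rowExpansion-sound k (W ∘ suc) (U ∪｛ j ｝)) (rowExpansion-shift W k 0 (U ∪｛ j ｝)))))

  isInjectiveᵇ-spec : ∀ {k} (f : Fin k → Fin k) → T (isInjectiveᵇ f) ⇔ Injective f
  isInjectiveᵇ-spec f = mk⇔
    (λ h i j → Equivalence.to (pair i j) (Equivalence.to (all-allFin _) (Equivalence.to (all-allFin _) h i) j))
    (λ inj → Equivalence.from (all-allFin _) λ i → Equivalence.from (all-allFin _) λ j →
               Equivalence.from (pair i j) (inj i j))
    where
    pair : ∀ i j → T (⌊ i ≟ j ⌋ ∨ not ⌊ f i ≟ f j ⌋) ⇔ (f i ≡ f j → i ≡ j)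
    pair i j with i ≟ j | f i ≟ f j
    ... | yes i≡j | _         = mk⇔ (λ _ _ → i≡j) (λ _ → tt)
    ... | no  i≢j | yes fi≡fj = mk⇔ (λ ()) (λ h → i≢j (h fi≡fj))
    ... | no  _   | no  fi≢fj = mk⇔ (λ _ fi≡fj → ⊥-elim (fi≢fj fi≡fj)) (λ _ → tt)

  isInjectiveᵇ≡fresh : ∀ {k} (f : Fin k → Fin k) → isInjectiveᵇ f ≡ fresh (λ _ → false) f
  isInjectiveᵇ≡fresh f = T-injective (mk⇔
    (λ t → Equivalence.from (fresh-spec _ f) (Equivalence.to (isInjectiveᵇ-spec f) t , λ _ → tt))
    (λ t → Equivalence.from (isInjectiveᵇ-spec f) (proj₁ (Equivalence.to (fresh-spec _ f) t))))

  pathWeight : List Label → Poly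
  pathWeight w = ΠP (map ⟦_⟧ w)

  module Adjacency (size : ℕ) (s t : Fin size) (out : Fin size → List (Fin size × Label))
                   (forward : ∀ u → All (λ e → toℕ u < toℕ (proj₁ e)) (out u)) where

    abp : ABP
    abp = record
      { size    = size
      ; s       = s
      ; t       = t
      ; edges   = concatMap (λ u → map (u ,_) (out u)) (allFin size)
      ; acyclic = AllP.concat⁺ (AllP.map⁺ (AllP.tabulate⁺ (λ u → AllP.map⁺ (forward u))))
      }

    pathSum : ℕ → Fin size → Poly
    pathSum k u = Σ pathWeight (ABP.pathsFrom abp k u)

    pathSum-zero : ∀ u → pathSum 0 u ≃ 𝟙 when ⌊ u ≟ t ⌋
    pathSum-zero u with ⌊ u ≟ t ⌋
    ... | true  = ⊕-idʳ 𝟙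
    ... | false = ≃-refl

    pathSum-suc : ∀ k u → pathSum (suc k) u ≃ Σ (λ e → ⟦ proj₂ e ⟧ ⊗ pathSum k (proj₁ e)) (out u)
    pathSum-suc k u = begin
      pathSum (suc k) u
        ≈⟨ Σ-concatMap pathWeight _ (ABP.edges abp) ⟩
      Σ (λ e → Σ pathWeight (extend e)) (ABP.edges abp)
        ≈⟨ Σ-cong (ABP.edges abp) byEdge ⟩
      Σ edgeTerm (ABP.edges abp)
        ≈⟨ Σ-concatMap edgeTerm _ (allFin size) ⟩
      Σ (λ u′ → Σ edgeTerm (map (u′ ,_) (out u′))) (allFin size)
        ≈⟨ Σ-cong (allFin size) (λ u′ → ≃-trans (≡⇒≃ (Σ-map edgeTerm (u′ ,_) (out u′)))
                                                (Σ-when ⌊ u′ ≟ u ⌋ _ (out u′))) ⟩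
      Σ (λ u′ → Σ firstStep (out u′) when ⌊ u′ ≟ u ⌋) (allFin size)
        ≈⟨ Σ-δ _ u (λ u′ u′≢u → ≡⇒≃ (cong (Σ firstStep (out u′) when_) (⌊⌋-false (u′ ≟ u) u′≢u))) ⟩
      Σ firstStep (out u) when ⌊ u ≟ u ⌋
        ≡⟨ cong (Σ firstStep (out u) when_) (⌊⌋-true (u ≟ u) refl) ⟩
      Σ firstStep (out u)
        ∎
      where
      firstStep : Fin size × Label → Poly
      firstStep e = ⟦ proj₂ e ⟧ ⊗ pathSum k (proj₁ e)
      edgeTerm : Fin size × Fin size × Label → Poly
      edgeTerm e = firstStep (proj₂ e) when ⌊ proj₁ e ≟ u ⌋
      extend : Fin size × Fin size × Label → List (List Label)
      extend e = if ⌊ proj₁ e ≟ u ⌋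
                 then map (proj₂ (proj₂ e) ∷_) (ABP.pathsFrom abp k (proj₁ (proj₂ e))) else []
      byEdge : ∀ e → Σ pathWeight (extend e) ≃ edgeTerm e
      byEdge e with ⌊ proj₁ e ≟ u ⌋
      ... | false = ≃-refl
      ... | true  = ≃-trans (≡⇒≃ (Σ-map pathWeight (proj₂ (proj₂ e) ∷_) paths))
                            (≃-sym (Σ-⊗ˡ ⟦ proj₂ (proj₂ e) ⟧ pathWeight paths))
        where paths : List (List Label)
              paths = ABP.pathsFrom abp k (proj₁ (proj₂ e))

    output-pathSum : output abp ≃ Σ (λ k → pathSum k s) (upTo (suc size))
    output-pathSum = Σ-concatMap pathWeight (λ k → ABP.pathsFrom abp k s) (upTo (suc size))

  run : ∀ {ℓs} {State : Set ℓs} → (ℕ → State → List (State × Label)) → ℕ → ℕ → State → Poly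
  run step zero    l β = 𝟙
  run step (suc k) l β = Σ (λ m → ⟦ proj₂ m ⟧ ⊗ run step k (suc l) (proj₁ m)) (step l β)

  -- A layered state machine — layer l lists (at most N) states, and step l β lists the
  -- labelled transitions from β in layer l to states of layer l+1 — as an ABP with
  -- (n+1)·N nodes: node (l , i) stands for the i-th state of layer l.
  module Layered {ℓs} {State : Set ℓs} (_≟ₛ_ : DecidableEquality State) (n N : ℕ)
                 (layer : ℕ → List State) (narrow : ∀ l → length (layer l) ≤ N)
                 (step : ℕ → State → List (State × Label))
                 (closed : ∀ l {β} → β ∈ layer l → All (λ m → proj₁ m ∈ layer (suc l)) (step l β))
                 (sink : length (layer n) ≤ 1)
                 (initial : State) (initial∈ : initial ∈ layer 0) where

    open import Data.List.Membership.DecPropositional _≟ₛ_ using (_∈?_)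

    N>0 : 0 < N
    N>0 = ℕP.<-≤-trans (nonempty initial∈) (narrow 0)
      where nonempty : ∀ {x} {xs : List State} → x ∈ xs → 0 < length xs
            nonempty (here _)  = s≤s z≤n
            nonempty (there _) = s≤s z≤n

    slot : ∀ {l β} → β ∈ layer l → Fin N
    slot {l} p = Fin.inject≤ (Any.index p) (narrow l)

    node : ∀ {l} → l < suc n → Fin N → Fin (suc n * N)
    node l<1+n i = combine (fromℕ< l<1+n) i

    stateAt : ℕ → Fin N → Maybe State
    stateAt l i with toℕ i <? length (layer l)
    ... | yes i<len = just (List.lookup (layer l) (fromℕ< i<len))
    ... | no  _     = nothing

    stateAt-slot : ∀ {l β} (p : β ∈ layer l) → stateAt l (slot p) ≡ just β
    stateAt-slot {l} p with toℕ (slot p) <? length (layer l)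
    ... | yes i<len = cong just (trans (cong (List.lookup (layer l)) (FinP.toℕ-injective
                        (trans (FinP.toℕ-fromℕ< i<len) (FinP.toℕ-inject≤ (Any.index p) (narrow l)))))
                        (sym (lookup-index p)))
    ... | no  i≮len = ⊥-elim (i≮len (subst (_< length (layer l)) (sym (FinP.toℕ-inject≤ (Any.index p) (narrow l)))
                                       (FinP.toℕ<n (Any.index p))))

    edgeTo : ∀ {l} → l < n → State × Label → List (Fin (suc n * N) × Label)
    edgeTo {l} l<n (β′ , ℓ) with β′ ∈? layer (suc l)
    ... | yes q = [ (node (s≤s l<n) (slot q) , ℓ) ]
    ... | no  _ = []

    outgoing : ℕ → Fin N → List (Fin (suc n * N) × Label)
    outgoing l i with l <? n | stateAt l i
    ... | yes l<n | just β = concatMap (edgeTo l<n) (step l β)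
    ... | _       | _      = []

    out : Fin (suc n * N) → List (Fin (suc n * N) × Label)
    out u = outgoing (toℕ (proj₁ (remQuot {suc n} N u))) (proj₂ (remQuot {suc n} N u))

    out-node : ∀ {l} (l<1+n : l < suc n) i → out (node l<1+n i) ≡ outgoing l i
    out-node l<1+n i =
      trans (cong (λ Li → outgoing (toℕ (proj₁ Li)) (proj₂ Li)) (FinP.remQuot-combine {suc n} {N} (fromℕ< l<1+n) i))
            (cong (λ m → outgoing m i) (FinP.toℕ-fromℕ< l<1+n))

    -- Every edge goes from layer l to layer l+1, hence forward.
    outgoing-forward : ∀ L i → All (λ e → toℕ (combine L i) < toℕ (proj₁ e)) (outgoing (toℕ L) i)
    outgoing-forward L i with toℕ L <? n | stateAt (toℕ L) i
    ... | yes l<n | just β  = AllP.concat⁺ (AllP.map⁺ (All.universal edge-forward (step (toℕ L) β)))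
      where
      edge-forward : ∀ m → All (λ e → toℕ (combine L i) < toℕ (proj₁ e)) (edgeTo l<n m)
      edge-forward (β′ , ℓ) with β′ ∈? layer (suc (toℕ L))
      ... | yes q = FinP.combine-monoˡ-< i (slot q)
                      (subst (toℕ L <_) (sym (FinP.toℕ-fromℕ< (s≤s l<n))) (ℕP.n<1+n (toℕ L))) ∷ []
      ... | no  _ = []
    ... | yes _   | nothing = []
    ... | no  _   | _       = []

    forward : ∀ u → All (λ e → toℕ u < toℕ (proj₁ e)) (out u)
    forward u = subst (λ v → All (λ e → toℕ v < toℕ (proj₁ e)) (out u)) (FinP.combine-remQuot {suc n} N u)
                      (outgoing-forward (proj₁ (remQuot {suc n} N u)) (proj₂ (remQuot {suc n} N u)))

    source target : Fin (suc n * N)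
    source = node (s≤s z≤n) (slot initial∈)
    target = node (ℕP.n<1+n n) (fromℕ< N>0)

    open Adjacency (suc n * N) source target out forward public using (abp)
    open Adjacency (suc n * N) source target out forward using (pathSum; pathSum-zero; pathSum-suc; output-pathSum)

    -- A slot of the last layer is the target (the last layer has at most one state).
    slot-sink : ∀ {β} (p : β ∈ layer n) → slot p ≡ fromℕ< N>0
    slot-sink p = FinP.toℕ-injective (trans (FinP.toℕ-inject≤ (Any.index p) (narrow n))
                    (trans (ℕP.n<1⇒n≡0 (ℕP.<-≤-trans (FinP.toℕ<n (Any.index p)) sink))
                           (sym (FinP.toℕ-fromℕ< N>0))))

    at-target : ∀ {l} (l<1+n : l < suc n) {β} (p : β ∈ layer l) →
                ⌊ node l<1+n (slot p) ≟ target ⌋ ≡ (l + 0 ≡ᵇ n)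
    at-target {l} l<1+n p with l ℕP.≟ n
    ... | yes refl = trans (⌊⌋-true (_ ≟ target) (cong (combine {suc n} (fromℕ< l<1+n)) (slot-sink p)))
                           (sym (dec-true (l + 0 ℕP.≟ l) (ℕP.+-identityʳ l)))
    ... | no  l≢n  = trans (⌊⌋-false (_ ≟ target) (λ e → l≢n (trans (sym (FinP.toℕ-fromℕ< l<1+n))
                             (trans (cong toℕ (FinP.combine-injectiveˡ _ _ _ _ e)) (FinP.toℕ-fromℕ< (ℕP.n<1+n n))))))
                           (sym (dec-false (l + 0 ℕP.≟ n) (l≢n ∘ trans (sym (ℕP.+-identityʳ l)))))

    overshoot : ∀ {l} k → ¬ l < n → (l + suc k ≡ᵇ n) ≡ false
    overshoot {l} k l≮n = dec-false (l + suc k ℕP.≟ n)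
      (λ e → ℕP.<-irrefl (sym e) (ℕP.≤-<-trans (ℕP.≮⇒≥ l≮n) (ℕP.m<m+n l (s≤s z≤n))))

    -- One more layer of the invariant below: decompose along the first edge, whose
    -- target is the node of the next state.
    pathSum-step : ∀ k →
      (∀ {l} (l<1+n : l < suc n) {β} (p : β ∈ layer l) →
         pathSum k (node l<1+n (slot p)) ≃ run step k l β when (l + k ≡ᵇ n)) →
      ∀ {l} (l<1+n : l < suc n) {β} (p : β ∈ layer l) →
        pathSum (suc k) (node l<1+n (slot p)) ≃ run step (suc k) l β when (l + suc k ≡ᵇ n)
    pathSum-step k ih {l} l<1+n {β} p =
      ≃-trans (pathSum-suc k _) (subst (λ es → Σ firstStep es ≃ run step (suc k) l β when guard)
                                       (sym (out-node l<1+n (slot p))) layerStep)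
      where
      firstStep : Fin (suc n * N) × Label → Poly
      firstStep e = ⟦ proj₂ e ⟧ ⊗ pathSum k (proj₁ e)
      guard : Bool
      guard = l + suc k ≡ᵇ n
      guard′ : (suc l + k ≡ᵇ n) ≡ guard
      guard′ = cong (_≡ᵇ n) (sym (ℕP.+-suc l k))
      edgeStep : ∀ (l<n : l < n) {m} → proj₁ m ∈ layer (suc l) →
                 Σ firstStep (edgeTo l<n m) ≃ ⟦ proj₂ m ⟧ ⊗ run step k (suc l) (proj₁ m) when guard
      edgeStep l<n {β′ , ℓ} q′ with β′ ∈? layer (suc l)
      ... | yes q = ≃-trans (⊕-idʳ _) (⊗-cong ≃-refl
                      (≃-trans (ih (s≤s l<n) q) (≡⇒≃ (cong (run step k (suc l) β′ when_) guard′))))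
      ... | no q∉ = ⊥-elim (q∉ q′)
      layerStep : Σ firstStep (outgoing l (slot p)) ≃ run step (suc k) l β when guard
      layerStep with l <? n | stateAt l (slot p) | stateAt-slot p
      ... | yes l<n | just .β | refl = begin
        Σ firstStep (concatMap (edgeTo l<n) (step l β))
          ≈⟨ Σ-concatMap firstStep (edgeTo l<n) (step l β) ⟩
        Σ (λ m → Σ firstStep (edgeTo l<n m)) (step l β)
          ≈⟨ Σ-congᴬ (closed l p) (edgeStep l<n) ⟩
        Σ (λ m → ⟦ proj₂ m ⟧ ⊗ run step k (suc l) (proj₁ m) when guard) (step l β)
          ≈⟨ Σ-cong (step l β) (λ m → ⊗-when _ _ guard) ⟩
        Σ (λ m → (⟦ proj₂ m ⟧ ⊗ run step k (suc l) (proj₁ m)) when guard) (step l β)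
          ≈⟨ Σ-when guard _ (step l β) ⟩
        run step (suc k) l β when guard
          ∎
      ... | no l≮n | _ | _ = ≡⇒≃ (cong (run step (suc k) l β when_) (sym (overshoot k l≮n)))

    pathSum-layer : ∀ k {l} (l<1+n : l < suc n) {β} (p : β ∈ layer l) →
                    pathSum k (node l<1+n (slot p)) ≃ run step k l β when (l + k ≡ᵇ n)
    pathSum-layer zero    l<1+n p = ≃-trans (pathSum-zero _) (≡⇒≃ (cong (𝟙 when_) (at-target l<1+n p)))
    pathSum-layer (suc k) l<1+n p = pathSum-step k (pathSum-layer k) l<1+n p

    output-run : output abp ≃ run step n 0 initial
    output-run = begin
      output abp
        ≈⟨ output-pathSum ⟩
      Σ (λ k → pathSum k source) (upTo (suc (suc n * N)))
        ≈⟨ Σ-cong (upTo (suc (suc n * N))) (λ k → pathSum-layer k (s≤s z≤n) initial∈) ⟩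
      Σ (λ k → run step k 0 initial when (k ≡ᵇ n)) (upTo (suc (suc n * N)))
        ≈⟨ Σ-δ-upTo (λ k → run step k 0 initial) n _ (s≤s n≤size) ⟩
      run step n 0 initial
        ∎
      where
      n≤size : n ≤ suc n * N
      n≤size = ℕP.≤-trans (ℕP.n≤1+n n) (ℕP.m≤m*n (suc n) N {{ℕ.>-nonZero N>0}})

  module TwoCycles {n} (G : TwoCycleGraph n) where
    open TwoCycleGraph G
    open Involution π π-invol

    weight : Fin n → Fin n → Poly
    weight i j = maybe ⟦_⟧ 𝟘 (w i j)

    weight-support : ∀ i j → j ≢ i → j ≢ π i → weight i j ≡ 𝟘
    weight-support i j j≢i j≢πi with w i j in e
    ... | nothing = refl
    ... | just ℓ  with support i j ℓ e
    ...   | inj₁ j≡i  = ⊥-elim (j≢i j≡i)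
    ...   | inj₂ j≡πi = ⊥-elim (j≢πi j≡πi)

    weightℕ : ℕ → Fin n → Poly
    weightℕ i j with i <? n
    ... | yes i<n = weight (fromℕ< i<n) j
    ... | no  _   = 𝟘

    weightℕ-row : ∀ {i} (i<n : i < n) j → weightℕ i j ≡ weight (fromℕ< i<n) j
    weightℕ-row {i} i<n j with i <? n
    ... | yes _   = refl
    ... | no  i≮n = ⊥-elim (i≮n i<n)

    monomial-weight : ∀ (σ : Fin n → Fin n) →
                      monomial weightℕ σ ≡ ΠP (map (λ i → weight i (σ i)) (allFin n))
    monomial-weight σ = cong ΠP (LP.map-cong (λ i → trans (weightℕ-row (FinP.toℕ<n i) (σ i))
                                                          (cong (λ x → weight x (σ i)) (FinP.fromℕ<-toℕ i _)))
                                             (allFin n))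

    C-perm-expansion : C-perm G ≃ rowExpansion weightℕ n 0 (λ _ → false)
    C-perm-expansion = begin
      C-perm G
        ≈⟨ Σ-filter term isInjectiveᵇ (allFuns n n) ⟩
      Σ (λ σ → term σ when isInjectiveᵇ σ) (allFuns n n)
        ≈⟨ Σ-cong (allFuns n n) (λ σ → ≡⇒≃ (cong₂ _when_ (sym (monomial-weight σ)) (isInjectiveᵇ≡fresh σ))) ⟩
      Σ (summand weightℕ (λ _ → false)) (allFuns n n)
        ≈⟨ rowExpansion-sound n weightℕ (λ _ → false) ⟩
      rowExpansion weightℕ n 0 (λ _ → false)
        ∎
      where
      term : (Fin n → Fin n) → Poly
      term σ = ΠP (map (λ i → weight i (σ i)) (allFin n))

    -- One row of the machine performs one step of the row expansion.
    module RowStep {i} (i<n : i < n) (R : (Fin n → Bool) → Poly)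
                   (R-cong : ∀ {U U′} → (∀ x → U x ≡ U′ x) → R U ≃ R U′)
                   {β} (sβ : Supported (isOpen i) β) where
      open Row i<n

      term : Fin n → Poly
      term j = (weight v j ⊗ R (used i β ∪｛ j ｝)) when not (used i β j)

      legal-term : ∀ {m} → Legal β m → weight v (proj₁ m) ⊗ R (used (suc i) (proj₂ m)) ≃ term (proj₁ m)
      legal-term {j , β′} legal = ≃-trans (⊗-cong ≃-refl (R-cong (Legal.update legal)))
        (≡⇒≃ (sym (cong ((weight v j ⊗ R (used i β ∪｛ j ｝)) when_) (cong not (Legal.free legal)))))

      blocked : ∀ {j} → used i β j ≡ true → term j ≃ 𝟘
      blocked {j} u = ≡⇒≃ (cong ((weight v j ⊗ R (used i β ∪｛ j ｝)) when_) (cong not u))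

      elsewhere : ∀ {j} → j ≢ v → j ≢ p → term j ≃ 𝟘
      elsewhere {j} j≢v j≢p = ≃-trans (when-cong _ (≃-trans (⊗-cong (≡⇒≃ (weight-support v j j≢v j≢p)) ≃-refl)
                                                            (⊗-zeroˡ _)))
                                      (𝟘-when _)

      -- the moves list exactly the columns whose term may be nonzero
      select : Σ (term ∘ proj₁) (moves v β) ≃ Σ term (allFin n)
      select with π v ≟ v | toℕ v <? toℕ (π v) | lookup β (π v) in βp
      ... | yes p≡v | _       | _     =
        ≃-trans (⊕-idʳ _) (≃-sym (Σ-δ term v (λ j j≢v → elsewhere j≢v (λ j≡p → j≢v (trans j≡p p≡v)))))
      ... | no  p≢v | yes _   | _     =
        ≃-trans (⊕-cong ≃-refl (⊕-idʳ _)) (≃-sym (Σ-δ₂ term v p (p≢v ∘ sym) (λ j → elsewhere)))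
      ... | no  p≢v | no  v≮p | true  =
        ≃-trans (⊕-idʳ _) (≃-sym (Σ-δ term p zero-off-p))
        where
        zero-off-p : ∀ j → j ≢ p → term j ≃ 𝟘
        zero-off-p j j≢p with j ≟ v
        ... | yes refl = blocked (trans (Closing.used-v (partner<v p≢v v≮p) β) βp)
        ... | no  j≢v  = elsewhere j≢v j≢p
      ... | no  p≢v | no  v≮p | false =
        ≃-trans (⊕-idʳ _) (≃-sym (Σ-δ term v zero-off-v))
        where
        zero-off-v : ∀ j → j ≢ v → term j ≃ 𝟘
        zero-off-v j j≢v with j ≟ p
        ... | yes refl = blocked (trans (Closing.used-p (partner<v p≢v v≮p) β) (cong not βp))
        ... | no  j≢p  = elsewhere j≢v j≢p

      rowStep : Σ (λ m → weight v (proj₁ m) ⊗ R (used (suc i) (proj₂ m))) (moves v β) ≃ Σ term (allFin n)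
      rowStep = ≃-trans (Σ-congᴬ (moves-legal sβ) legal-term) select

    label : Fin n → Fin n → Label
    label i j = maybe id (const 0#) (w i j)

    ⟦label⟧ : ∀ i j → ⟦ label i j ⟧ ≡ weight i j
    ⟦label⟧ i j with w i j
    ... | just _  = refl
    ... | nothing = refl

    layer : ℕ → List (Vec Bool n)
    layer i = filterᵇ (supportedIn (isOpen i)) (allVecs n)

    ∈-layer⁺ : ∀ i {β} → Supported (isOpen i) β → β ∈ layer i
    ∈-layer⁺ i {β} sβ = ∈-filter⁺ {P = T ∘ supportedIn (isOpen i)} (T? ∘ supportedIn (isOpen i)) (∈-allVecs β)
                                    (Equivalence.from T-≡ (supportedIn-complete _ β sβ))

    ∈-layer⁻ : ∀ i {β} → β ∈ layer i → Supported (isOpen i) β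
    ∈-layer⁻ i {β} β∈ = supportedIn-sound _ β (Equivalence.to T-≡ (proj₂
      (∈-filter⁻ {P = T ∘ supportedIn (isOpen i)} (T? ∘ supportedIn (isOpen i)) {xs = allVecs n} β∈)))

    step : ℕ → Vec Bool n → List (Vec Bool n × Label)
    step i β with i <? n
    ... | yes i<n = map (λ m → proj₂ m , label (fromℕ< i<n) (proj₁ m)) (moves (fromℕ< i<n) β)
    ... | no  _   = []

    closed : ∀ i {β} → β ∈ layer i → All (λ m → proj₁ m ∈ layer (suc i)) (step i β)
    closed i β∈ with i <? n
    ... | yes i<n = AllP.map⁺ (All.map (∈-layer⁺ (suc i)) (Row.moves-next i<n (∈-layer⁻ i β∈)))
    ... | no  _   = []

    run-expansion : ∀ k i {β} → β ∈ layer i → run step k i β ≃ rowExpansion weightℕ k i (used i β)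
    run-expansion zero    i β∈ = ≃-refl
    run-expansion (suc k) i {β} β∈ with i <? n
    ... | yes i<n = begin
      Σ (λ m → ⟦ proj₂ m ⟧ ⊗ run step k (suc i) (proj₁ m)) (map (λ m → proj₂ m , label v (proj₁ m)) (moves v β))
        ≡⟨ Σ-map _ _ (moves v β) ⟩
      Σ (λ m → ⟦ label v (proj₁ m) ⟧ ⊗ run step k (suc i) (proj₂ m)) (moves v β)
        ≈⟨ Σ-congᴬ (Row.moves-next i<n sβ)
                   (λ {m} s′ → ⊗-cong (≡⇒≃ (⟦label⟧ v (proj₁ m))) (run-expansion k (suc i) (∈-layer⁺ (suc i) s′))) ⟩
      Σ (λ m → weight v (proj₁ m) ⊗ rowExpansion weightℕ k (suc i) (used (suc i) (proj₂ m))) (moves v β)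
        ≈⟨ RowStep.rowStep i<n (rowExpansion weightℕ k (suc i)) (rowExpansion-congᵁ weightℕ k (suc i)) sβ ⟩
      Σ (λ j → (weight v j ⊗ rowExpansion weightℕ k (suc i) (used i β ∪｛ j ｝)) when not (used i β j)) (allFin n)
        ∎
      where
      v : Fin n
      v = fromℕ< i<n
      sβ : Supported (isOpen i) β
      sβ = ∈-layer⁻ i β∈
    ... | no  i≮n = ≃-sym (Σ-zero (allFin n) λ j →
      ≃-trans (when-cong _ (⊗-zeroˡ _)) (𝟘-when _))

    open-count : ∀ i → count (isOpen i) ≤ cut G
    open-count i with i <? n
    ... | no  i≮n = ℕP.≤-trans (ℕP.≤-reflexive (count-none (isOpen i) none)) z≤n
      where
      none : ∀ x → isOpen i x ≡ false
      none x = dec-false (open? i x) (λ (_ , _ , i≤πx) → i≮n (ℕP.≤-<-trans i≤πx (FinP.toℕ<n (π x))))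
    ... | yes i<n = ℕP.≤-trans (countIn-mono (isOpen i) crosses open⇒crosses (allFin n))
                              (≤-foldr-⊔ (crossing π) (∈-allFin k))
      where
      k : Fin n
      k = fromℕ< i<n
      crosses : Fin n → Bool
      crosses j = (toℕ j <ᵇ toℕ (π j)) ∧ (toℕ j ≤ᵇ toℕ k) ∧ (toℕ k ≤ᵇ toℕ (π j))
      open⇒crosses : ∀ x → isOpen i x ≡ true → crosses x ≡ true
      open⇒crosses x o with (x<πx , x<i , i≤πx) ← does⇒ (open? i x) o =
        Equivalence.to T-≡ (Equivalence.from T-∧ (ℕP.<⇒<ᵇ x<πx , Equivalence.from T-∧
          (ℕP.≤⇒≤ᵇ (subst (toℕ x ≤_) (sym (FinP.toℕ-fromℕ< i<n)) (ℕP.<⇒≤ x<i)) ,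
           ℕP.≤⇒≤ᵇ (subst (_≤ toℕ (π x)) (sym (FinP.toℕ-fromℕ< i<n)) i≤πx))))

    narrow : ∀ i → length (layer i) ≤ 2 ^ cut G
    narrow i = subst (_≤ 2 ^ cut G) (sym (countIn-supported (isOpen i))) (ℕP.^-monoʳ-≤ 2 (open-count i))

    -- Nothing is open at the last layer, so it holds a single state.
    sink : length (layer n) ≤ 1
    sink = ℕP.≤-reflexive (trans (countIn-supported (isOpen n)) (cong (2 ^_) (count-none (isOpen n) none)))
      where
      none : ∀ x → isOpen n x ≡ false
      none x = dec-false (open? n x) (λ (_ , _ , n≤πx) → ℕP.<-irrefl refl (ℕP.≤-<-trans n≤πx (FinP.toℕ<n (π x))))

    initial : Vec Bool n
    initial = replicate n false

    initial∈ : initial ∈ layer 0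
    initial∈ = ∈-layer⁺ 0 (supported λ x t → ⊥-elim (BoolP.not-¬ t (VecP.lookup-replicate x false)))

    nothing-open : ∀ y → isOpen 0 y ≡ false
    nothing-open y = dec-false (open? 0 y) (λ { (_ , () , _) })

    used-initial : ∀ x → used 0 initial x ≡ false
    used-initial x rewrite nothing-open x | nothing-open (π x) = dec-false (toℕ x <? 0) (λ ())

    open Layered (VecP.≡-dec BoolP._≟_) n (2 ^ cut G) layer narrow step closed sink initial initial∈
      public using (abp; output-run)

    abp-computes : output abp ≃ C-perm G
    abp-computes = begin
      output abp                                 ≈⟨ output-run ⟩
      run step n 0 initial                       ≈⟨ run-expansion n 0 initial∈ ⟩
      rowExpansion weightℕ n 0 (used 0 initial)  ≈⟨ rowExpansion-congᵁ weightℕ n 0 used-initial ⟩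
      rowExpansion weightℕ n 0 (λ _ → false)     ≈⟨ ≃-sym C-perm-expansion ⟩
      C-perm G                                   ∎

size-bound : ∀ n c → 1 ≤ n → suc n * 2 ^ c ≤ 2 ^ (1 * c + 1) * n ^ 2
size-bound n c 1≤n = ℕP.≤-trans (ℕP.*-monoˡ-≤ (2 ^ c) 1+n≤2n²) (ℕP.≤-reflexive reorder)
  where
  n≤n² : n ≤ n * n
  n≤n² = ℕP.m≤m*n n n {{ℕ.>-nonZero 1≤n}}
  1+n≤2n² : suc n ≤ 2 * (n * n)
  1+n≤2n² = ℕP.≤-trans (ℕP.+-monoˡ-≤ n 1≤n)
              (ℕP.≤-trans (ℕP.+-mono-≤ n≤n² n≤n²) (ℕP.≤-reflexive (cong (n * n +_) (sym (ℕP.+-identityʳ _)))))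
  reorder : 2 * (n * n) * 2 ^ c ≡ 2 ^ (1 * c + 1) * n ^ 2
  reorder = trans (ℕP.*-comm (2 * (n * n)) (2 ^ c))
    (trans (sym (ℕP.*-assoc (2 ^ c) 2 (n * n)))
      (sym (cong₂ _*_ (trans (cong (λ e → 2 ^ (e + 1)) (ℕP.*-identityˡ c)) (ℕP.^-distribˡ-+-* 2 c 1))
                      (cong (n *_) (ℕP.*-identityʳ n)))))

lemma2 : ∀ {a ℓa r ℓr} (K : Field a ℓa) (𝓡 : Algebra K r ℓr) →
    let open Over K 𝓡 in
    ∃₂ λ (c d : ℕ) → ∀ (n : ℕ) → 1 ≤ n → (G : TwoCycleGraph n) →
      ∃ λ (A : ABP) →
        (ABP.size A ≤ 2 ^ (c * cut G + d) * n ^ 2) × (ABP.output A ≃ C-perm G)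
lemma2 K 𝓡 = 1 , 1 , λ n 1≤n G →
  let open Construction.TwoCycles K 𝓡 G in abp , size-bound n (Over.cut K 𝓡 G) 1≤n , abp-computes
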